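{- Let $a$ be a weak composition. The destandardization map $\mathrm{dst}$ is well-defined on $\mathrm{KT}(a)$ and satisfies: (1) for $T\in\mathrm{KT}(a)$, $\mathrm{dst}(T)\in\mathrm{QKT}(a)$; (2) for $T\in\mathrm{KT}(a)$, $\mathrm{dst}(T)=T$ if and only if $T\in\mathrm{QKT}(a)$; (3) $\mathrm{dst}:\mathrm{KT}(a)\to\mathrm{QKT}(a)$ is surjective; (4) $\mathrm{dst}:\mathrm{KT}(a)\to\mathrm{QKT}(a)$ is injective if and only if $a_i=0$ implies $a_j=0$ for all $j>i$.
   Context: A weak composition of length $n$ is $a=(a_1,\dots,a_n)$ with $a_i\in\mathbb{Z}_{\ge0}$. A diagram is a finite set of cells in $\mathbb{N}\times\mathbb{N}$ (row $r\ge1$, column $c\ge1$), rows indexed from the bottom. A Kohnert tableau of content $a$ is a diagram whose cells are filled, one entry per cell, with the multiset $1^{a_1},\dots,n^{a_n}$, such that: (i) for each $i$, there is exactly one entry $i$ in each of columns $1,\dots,a_i$; (ii) every entry in row $r$ is at least $r$; (iii) the cells with entry $i$ weakly descend from left to right; (iv) if $i<j$ appear in the same column with the $i$ above the $j$, then there is an $i$ in the column immediately to the right, in a row strictly above the row of that $j$. $\mathrm{KT}(a)$ denotes the set of these. A Kohnert tableau is quasi-Yamanouchi if for each nonempty row $r$, either some cell in row $r$ has entry $r$, or some cell in row $r+1$ lies weakly right of some cell in row $r$; $\mathrm{QKT}(a)$ is the set of quasi-Yamanouchi Kohnert tableaux of content $a$. For $T\in\mathrm{KT}(a)$, $\mathrm{dst}(T)$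 is constructed as follows: whenever there is a row $r$ such that every cell in row $r$ lies strictly right of every cell in row $r+1$ and the leftmost cell of row $r$ has entry larger than $r$, move every cell of row $r$ (with its entry, staying in its column) up to row $r+1$; repeat until no such row exists. -}

module Defs where

open import Data.Nat using (ℕ; zero; suc; _≤_; _<_; _≟_)
open import Data.Fin using (Fin; toℕ) renaming (_<_ to _<ᶠ_)
open import Data.Product using (Σ; _×_; _,_)
open import Data.Sum using (_⊎_)
open import Data.Bool using (if_then_else_)
open import Relation.Nullary using (¬_)
open import Relation.Nullary.Decidable using (⌊_⌋)
open import Relation.Binary.PropositionalEquality using (_≡_)
open import Relation.Binary.Construct.Closure.ReflexiveTransitive using (Star)

-- A weak composition of length n is a : Fin n → ℕ  (a (i) is a_{i+1}).
--
-- Encoding of a filled diagram of content a satisfying condition (i):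
-- for each entry index i : Fin n (standing for the entry i+1) and each
-- column index c : Fin (a i) (standing for the column c+1), T i c is the
-- row of the (unique) cell in column c+1 filled with the entry i+1.
-- The diagram is the set of cells (T i c , c+1); its filling is
-- (T i c , c+1) ↦ i+1.  Condition (i) and the content 1^{a_1}…n^{a_n}
-- are thus built into the data; that cells are distinct is `Distinct`.
Filling : {n : ℕ} → (Fin n → ℕ) → Set
Filling {n} a = (i : Fin n) → Fin (a i) → ℕ

ent : {n : ℕ} → Fin n → ℕ
ent i = suc (toℕ i)

col : {m : ℕ} → Fin m → ℕ
col c = suc (toℕ c)

-- equality of fillings = equality of filled diagrams
_≋_ : {n : ℕ} {a : Fin n → ℕ} → Filling a → Filling a → Set
_≋_ {n} {a} T U = (i : Fin n) (c : Fin (a i)) → T i c ≡ U i c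

module _ {n : ℕ} {a : Fin n → ℕ} where

  RowsPositive : Filling a → Set
  RowsPositive T = (i : Fin n) (c : Fin (a i)) → 1 ≤ T i c

  Distinct : Filling a → Set
  Distinct T = (i j : Fin n) (c : Fin (a i)) (d : Fin (a j)) →
               col c ≡ col d → T i c ≡ T j d → i ≡ j

  CondII : Filling a → Set
  CondII T = (i : Fin n) (c : Fin (a i)) → T i c ≤ ent i

  CondIII : Filling a → Set
  CondIII T = (i : Fin n) (c d : Fin (a i)) → col c < col d → T i d ≤ T i c

  CondIV : Filling a → Set
  CondIV T = (i j : Fin n) (c : Fin (a i)) (d : Fin (a j)) →
             i <ᶠ j → col c ≡ col d → T j d < T i c →
             Σ (Fin (a i)) λ e → col e ≡ suc (col c) × T j d < T i e

  KT : Filling a → Set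
  KT T = RowsPositive T × Distinct T × CondII T × CondIII T × CondIV T

  NonemptyRow : Filling a → ℕ → Set
  NonemptyRow T r = Σ (Fin n) λ i → Σ (Fin (a i)) λ c → T i c ≡ r

  QuasiYamanouchi : Filling a → Set
  QuasiYamanouchi T = (r : ℕ) → NonemptyRow T r →
    (Σ (Fin n) λ i → Σ (Fin (a i)) λ c → T i c ≡ r × ent i ≡ r)
    ⊎ (Σ (Fin n) λ i → Σ (Fin (a i)) λ c → Σ (Fin n) λ j → Σ (Fin (a j)) λ d →
         T i c ≡ r × T j d ≡ suc r × col c ≤ col d)

  QKT : Filling a → Set
  QKT T = KT T × QuasiYamanouchi T

  Movable : Filling a → ℕ → Set
  Movable T r =
    ((i j : Fin n) (c : Fin (a i)) (d : Fin (a j)) →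
       T i c ≡ r → T j d ≡ suc r → col d < col c)
    × (Σ (Fin n) λ i → Σ (Fin (a i)) λ c →
         T i c ≡ r × ((j : Fin n) (d : Fin (a j)) → T j d ≡ r → col c ≤ col d)
         × r < ent i)

  moveRow : Filling a → ℕ → Filling a
  moveRow T r i c = if ⌊ T i c ≟ r ⌋ then suc r else T i c

  DstStep : Filling a → Filling a → Set
  DstStep T U = Σ ℕ λ r → Movable T r × U ≡ moveRow T r

  DstTerminal : Filling a → Set
  DstTerminal T = (r : ℕ) → ¬ Movable T r

  Dst : Filling a → Filling a → Set
  Dst T U = Star DstStep T U × DstTerminal U

-- A move raises every cell of a movable row by one. It preserves Kohnert tableaux and strictly
-- decreases the sum over all cells of (n - row), so the procedure terminates. Two moves available
-- at a Kohnert tableau can always be rejoined up to pointwise equality of fillings (they commute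
-- when the rows are not adjacent; for adjacent rows both orders end with the two rows stacked two
-- rows up), so by Newman's lemma the outcome is unique. A Kohnert tableau admits no move exactly
-- when it is quasi-Yamanouchi, which gives (1)-(3). For (4): if no a_i = 0 is followed by some
-- a_j > 0, induction on the entries puts the first cell of each entry i in row i, which forbids
-- every move, so dst is the identity. If a_q = 0 < a_{q+1}, the tableau with every entry i in
-- row i and the one obtained from it by lowering entry q+1 into the empty row q have the same
-- destandardization.
module Submission where

open import Defs
open import Data.Nat using (ℕ; zero; suc; _≤_; _<_; _∸_; z≤n; s≤s)
open import Data.Nat.Properties
open import Data.Nat.Induction using (<-wellFounded)
open import Data.Fin using (Fin; toℕ; fromℕ<) renaming (_<_ to _<ᶠ_; zero to fzero; suc to fsuc)
import Data.Fin.Properties as Fin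
open import Data.Product using (Σ; Σ-syntax; ∃; ∃₂; _×_; _,_; -,_; proj₁)
open import Data.Sum using (inj₁; inj₂)
open import Data.Bool using (if_then_else_)
open import Function.Base using (flip; _∘_)
open import Function.Bundles using (_⇔_; mk⇔)
open import Induction.WellFounded using (Acc; acc; module Subrelation)
open import Level using (0ℓ)
open import Relation.Binary.Core using (Rel)
open import Relation.Binary.Structures using (IsEquivalence)
open import Relation.Binary.Rewriting using (IsNormalForm; HasNormalForm; StronglyNormalizing)
import Relation.Binary.Construct.On as On
open import Relation.Nullary using (¬_; Dec; yes; no; contradiction)
open import Relation.Nullary.Decidable using (⌊_⌋; _×-dec_; _→-dec_)
open import Relation.Unary using (Decidable)
open import Relation.Binary.PropositionalEquality
  using (_≡_; _≢_; refl; sym; trans; cong; subst; subst₂; ≢-sym; module ≡-Reasoning)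
open import Relation.Binary.Construct.Closure.ReflexiveTransitive using (Star; ε; _◅_; _◅◅_)
open import Relation.Binary.Construct.Closure.Transitive
  using (TransClosure; [_]; _∷_) renaming (wellFounded to wellFounded⁺)
open import Algebra.Properties.Monoid.Sum +-0-monoid using (sum; sum-syntax)

sum-mono-≤ : ∀ {k} {f g : Fin k → ℕ} → (∀ i → f i ≤ g i) → sum f ≤ sum g
sum-mono-≤ {zero}  f≤g = z≤n
sum-mono-≤ {suc k} f≤g = +-mono-≤ (f≤g fzero) (sum-mono-≤ (λ i → f≤g (fsuc i)))

sum-mono-< : ∀ {k} {f g : Fin k → ℕ} → (∀ i → f i ≤ g i) → (j : Fin k) → f j < g j → sum f < sum g
sum-mono-< f≤g fzero    fj<gj = +-mono-<-≤ fj<gj (sum-mono-≤ (λ i → f≤g (fsuc i)))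
sum-mono-< f≤g (fsuc j) fj<gj = +-mono-≤-< (f≤g fzero) (sum-mono-< (λ i → f≤g (fsuc i)) j fj<gj)

-- Relation.Binary.Rewriting proves Newman's lemma up to ≡, but moves of fillings commute only
-- pointwise (≋), and only on Kohnert tableaux.
module NewmanModulo
  {A : Set} {_≈_ _⟶_ : Rel A 0ℓ} (≈-isEquivalence : IsEquivalence _≈_)
  (⟶-resp-≈ : ∀ {a a′ b} → a ≈ a′ → a ⟶ b → ∃ λ b′ → a′ ⟶ b′ × b ≈ b′)
  (Inv : A → Set) (Inv-step : ∀ {a b} → Inv a → a ⟶ b → Inv b)
  (weaklyConfluent : ∀ {a b c} → Inv a → a ⟶ b → a ⟶ c →
                     ∃₂ λ d d′ → Star _⟶_ b d × Star _⟶_ c d′ × d ≈ d′)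
  (stronglyNormalizing : StronglyNormalizing _⟶_)
  (step? : ∀ a → Dec (∃ λ b → a ⟶ b))
  where

  open IsEquivalence ≈-isEquivalence renaming (refl to ≈-refl; sym to ≈-sym; trans to ≈-trans)

  Inv-star : ∀ {a b} → Inv a → Star _⟶_ a b → Inv b
  Inv-star inv ε        = inv
  Inv-star inv (s ◅ ss) = Inv-star (Inv-step inv s) ss

  private
    _⟵⁺_ : Rel A 0ℓ
    _⟵⁺_ = TransClosure (flip _⟶_)

    ⟵⁺-star : ∀ {a b c} → b ⟵⁺ a → Star _⟶_ b c → c ⟵⁺ a
    ⟵⁺-star b⟵⁺a ε        = b⟵⁺a
    ⟵⁺-star b⟵⁺a (s ◅ ss) = ⟵⁺-star (s ∷ b⟵⁺a) ss

  normalise : ∀ a → HasNormalForm _⟶_ a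
  normalise a = go (stronglyNormalizing a)
    where
    go : ∀ {a} → Acc (flip _⟶_) a → HasNormalForm _⟶_ a
    go {a} (acc rs) with step? a
    ... | no  nf          = a , nf , ε
    ... | yes (b , a⟶b) = let c , nf , b↠c = go (rs a⟶b) in c , nf , a⟶b ◅ b↠c

  IsNormalForm-resp-≈ : ∀ {a a′} → a ≈ a′ → IsNormalForm _⟶_ a′ → IsNormalForm _⟶_ a
  IsNormalForm-resp-≈ a≈a′ nf′ (_ , a⟶b) =
    let _ , a′⟶b′ , _ = ⟶-resp-≈ a≈a′ a⟶b in nf′ (-, a′⟶b′)

  normalForm-unique : ∀ {a a′ b b′} → Inv a → a ≈ a′ → Star _⟶_ a b → Star _⟶_ a′ b′ →
                      IsNormalForm _⟶_ b → IsNormalForm _⟶_ b′ → b ≈ b′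
  -- Induction along ⟶⁺, so that the hypothesis also applies to the common reduct d.
  normalForm-unique = go (wellFounded⁺ (flip _⟶_) stronglyNormalizing _)
    where
    go : ∀ {a a′ b b′} → Acc _⟵⁺_ a → Inv a → a ≈ a′ → Star _⟶_ a b → Star _⟶_ a′ b′ →
         IsNormalForm _⟶_ b → IsNormalForm _⟶_ b′ → b ≈ b′
    go _ _ a≈a′ ε        ε         _  _   = a≈a′
    go _ _ a≈a′ ε        (s′ ◅ _) nf _   = contradiction (-, s′) (IsNormalForm-resp-≈ (≈-sym a≈a′) nf)
    go _ _ a≈a′ (s ◅ _) ε         _  nf′ = contradiction (-, s) (IsNormalForm-resp-≈ a≈a′ nf′)
    go (acc rs) inv a≈a′ (s ◅ b₁↠b) (s′ ◅ c₁′↠b′) nf nf′ =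
      let _ , t , c₁≈c₁′ = ⟶-resp-≈ (≈-sym a≈a′) s′
          d , d′ , b₁↠d , c₁↠d′ , d≈d′ = weaklyConfluent inv s t
          e , nf-e , d↠e = normalise d
          e′ , nf-e′ , d′↠e′ = normalise d′
          b≈e   = go (rs [ s ]) (Inv-step inv s) ≈-refl b₁↠b (b₁↠d ◅◅ d↠e) nf nf-e
          e≈e′  = go (rs (⟵⁺-star [ s ] b₁↠d)) (Inv-star (Inv-step inv s) b₁↠d) d≈d′ d↠e d′↠e′ nf-e nf-e′
          e′≈b′ = go (rs [ t ]) (Inv-step inv t) (≈-sym c₁≈c₁′) (c₁↠d′ ◅◅ d′↠e′) c₁′↠b′ nf-e′ nf′
      in ≈-trans b≈e (≈-trans e≈e′ e′≈b′)

n≢2+n : ∀ n → n ≢ suc (suc n)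
n≢2+n n = m≢1+n+m n {1}

raise : ℕ → ℕ → ℕ
raise r x = if ⌊ x ≟ r ⌋ then suc r else x

raise-≡ : ∀ {r x} → x ≡ r → raise r x ≡ suc r
raise-≡ {r} {x} x≡r with x ≟ r
... | yes _   = refl
... | no x≢r = contradiction x≡r x≢r

raise-≢ : ∀ {r x} → x ≢ r → raise r x ≡ x
raise-≢ {r} {x} x≢r with x ≟ r
... | yes x≡r = contradiction x≡r x≢r
... | no _    = refl

data RaiseView (r x : ℕ) : Set where
  raised : x ≡ r → raise r x ≡ suc r → RaiseView r x
  kept   : x ≢ r → raise r x ≡ x → RaiseView r x

raise-view : ∀ r x → RaiseView r x
raise-view r x with x ≟ r
... | yes x≡r = raised x≡r (raise-≡ x≡r)
... | no  x≢r = kept x≢r (raise-≢ x≢r)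

raise-inflationary : ∀ r x → x ≤ raise r x
raise-inflationary r x with raise-view r x
... | raised refl eq = subst (x ≤_) (sym eq) (n≤1+n x)
... | kept _ eq      = ≤-reflexive (sym eq)

raise-unmoved : ∀ {r x y} → raise r x ≡ y → y ≢ suc r → x ≡ y
raise-unmoved {r} {x} refl y≢1+r with raise-view r x
... | raised _ eq = contradiction eq y≢1+r
... | kept _ eq   = sym eq

raise-mono-≤ : ∀ r {x y} → x ≤ y → raise r x ≤ raise r y
raise-mono-≤ r {x} {y} x≤y with raise-view r x | raise-view r y
... | raised refl ex | raised refl ey = ≤-reflexive (trans ex (sym ey))
... | raised refl ex | kept y≢r ey    = subst₂ _≤_ (sym ex) (sym ey) (≤∧≢⇒< x≤y (y≢r ∘ sym))
... | kept _ ex      | raised refl ey = subst₂ _≤_ (sym ex) (sym ey) (≤-trans x≤y (n≤1+n r))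
... | kept _ ex      | kept _ ey      = subst₂ _≤_ (sym ex) (sym ey) x≤y

raise-cancel-< : ∀ r {x y} → raise r x < raise r y → x < y
raise-cancel-< r lt = ≰⇒> (λ y≤x → <⇒≱ lt (raise-mono-≤ r y≤x))

raise-mono-< : ∀ r {x y} → x < y → (x ≡ r → y ≢ suc r) → raise r x < raise r y
raise-mono-< r {x} {y} x<y ok with raise-view r x | raise-view r y
... | raised refl ex | raised refl ey = contradiction x<y (<-irrefl refl)
... | raised refl ex | kept _ ey      = subst₂ _<_ (sym ex) (sym ey) (≤∧≢⇒< x<y (ok refl ∘ sym))
... | kept _ ex      | raised refl ey = subst₂ _<_ (sym ex) (sym ey) (≤-trans x<y (n≤1+n r))
... | kept _ ex      | kept _ ey      = subst₂ _<_ (sym ex) (sym ey) x<y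

open ≡-Reasoning

raise-comm : ∀ {r s} → s ≢ r → s ≢ suc r → r ≢ suc s → ∀ x → raise s (raise r x) ≡ raise r (raise s x)
raise-comm {r} {s} s≢r s≢1+r r≢1+s x with raise-view r x | raise-view s x
... | raised x≡r ex | _ = begin
  raise s (raise r x) ≡⟨ cong (raise s) ex ⟩
  raise s (suc r)     ≡⟨ raise-≢ (s≢1+r ∘ sym) ⟩
  suc r               ≡⟨ sym ex ⟩
  raise r x           ≡⟨ cong (raise r) (sym (raise-≢ (s≢r ∘ sym ∘ trans (sym x≡r)))) ⟩
  raise r (raise s x) ∎
... | kept _ ex | raised _ ey = begin
  raise s (raise r x) ≡⟨ cong (raise s) ex ⟩
  raise s x           ≡⟨ ey ⟩
  suc s               ≡⟨ sym (raise-≢ (r≢1+s ∘ sym)) ⟩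
  raise r (suc s)     ≡⟨ cong (raise r) (sym ey) ⟩
  raise r (raise s x) ∎
... | kept _ ex | kept _ ey = begin
  raise s (raise r x) ≡⟨ cong (raise s) ex ⟩
  raise s x           ≡⟨ ey ⟩
  x                   ≡⟨ sym ex ⟩
  raise r x           ≡⟨ cong (raise r) (sym ey) ⟩
  raise r (raise s x) ∎

raise-adjacent : ∀ r x → raise (suc r) (raise r x) ≡ raise (suc r) (raise r (raise (suc r) x))
raise-adjacent r x with raise-view (suc r) x
... | kept _ ex         = cong (raise (suc r) ∘ raise r) (sym ex)
... | raised refl ex = begin
  raise (suc r) (raise r (suc r))         ≡⟨ cong (raise (suc r)) (raise-≢ 1+n≢n) ⟩
  raise (suc r) (suc r)                   ≡⟨ ex ⟩
  suc (suc r)                             ≡⟨ sym (raise-≢ 1+n≢n) ⟩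
  raise (suc r) (suc (suc r))             ≡⟨ cong (raise (suc r)) (sym (raise-≢ (≢-sym (n≢2+n r)))) ⟩
  raise (suc r) (raise r (suc (suc r)))   ≡⟨ cong (raise (suc r) ∘ raise r) (sym ex) ⟩
  raise (suc r) (raise r (raise (suc r) (suc r))) ∎

raise²-preimage : ∀ {r x} → raise r (raise (suc r) x) ≡ suc r → x ≡ r
raise²-preimage {r} {x} ex with raise-view (suc r) x | raise-view r x
... | raised _ ey | _ =
  contradiction (trans (sym (raise-≢ (≢-sym (n≢2+n r)))) (trans (cong (raise r) (sym ey)) ex)) 1+n≢n
... | kept _ _    | raised x≡r _ = x≡r
... | kept x≢1+r ey | kept _ ex′ = contradiction (trans (sym ex′) (trans (cong (raise r) (sym ey)) ex)) x≢1+r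

adjacent-switch : ∀ {n} {P : Fin n → Set} → Decidable P → ∀ {i j} → i <ᶠ j → P i → ¬ P j →
                  Σ[ q ∈ Fin n ] Σ[ q′ ∈ Fin n ] toℕ q′ ≡ suc (toℕ q) × P q × ¬ P q′
adjacent-switch {n} {P} P? {i} {j} i<j Pi ¬Pj = go i (<-wellFounded (toℕ j ∸ toℕ i)) i<j Pi
  where
  next : ∀ i → i <ᶠ j → Fin n
  next i i<j = fromℕ< (≤-<-trans i<j (Fin.toℕ<n j))

  toℕ-next : ∀ i (i<j : i <ᶠ j) → toℕ (next i i<j) ≡ suc (toℕ i)
  toℕ-next i i<j = Fin.toℕ-fromℕ< (≤-<-trans i<j (Fin.toℕ<n j))

  go : ∀ i → Acc _<_ (toℕ j ∸ toℕ i) → i <ᶠ j → P i →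
       Σ[ q ∈ Fin n ] Σ[ q′ ∈ Fin n ] toℕ q′ ≡ suc (toℕ q) × P q × ¬ P q′
  go i (acc rs) i<j Pi with P? (next i i<j)
  ... | no ¬Pi⁺ = i , next i i<j , toℕ-next i i<j , Pi , ¬Pi⁺
  ... | yes Pi⁺ = go (next i i<j) (rs closer) i⁺<j Pi⁺
    where
    i⁺<j : next i i<j <ᶠ j
    i⁺<j = ≤∧≢⇒< (subst (_≤ toℕ j) (sym (toℕ-next i i<j)) i<j)
                 (λ i⁺≡j → ¬Pj (subst P (Fin.toℕ-injective i⁺≡j) Pi⁺))
    closer : toℕ j ∸ toℕ (next i i<j) < toℕ j ∸ toℕ i
    closer = subst (λ k → toℕ j ∸ k < toℕ j ∸ toℕ i) (sym (toℕ-next i i<j))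
                   (∸-monoʳ-< (n<1+n (toℕ i)) i<j)

column₁ : ∀ {m} → m ≢ 0 → Fin m
column₁ {zero}  m≢0 = contradiction refl m≢0
column₁ {suc _} _   = fzero

col-column₁ : ∀ {m} (m≢0 : m ≢ 0) → col (column₁ m≢0) ≡ 1
col-column₁ {zero}  m≢0 = contradiction refl m≢0
col-column₁ {suc _} _   = refl

Fin⇒≢0 : ∀ {m} → Fin m → m ≢ 0
Fin⇒≢0 c refl = Fin.¬Fin0 c

col≤1⇒≡1 : ∀ {m} (c : Fin m) → col c ≤ 1 → col c ≡ 1
col≤1⇒≡1 c (s≤s c≤0) = cong suc (n≤0⇒n≡0 c≤0)

module _ {n : ℕ} {a : Fin n → ℕ} where

  ≋-isEquivalence : IsEquivalence (_≋_ {a = a})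
  ≋-isEquivalence = record
    { refl  = λ _ _ → refl
    ; sym   = λ T≋U i c → sym (T≋U i c)
    ; trans = λ T≋U U≋V i c → trans (T≋U i c) (U≋V i c)
    }

  open IsEquivalence ≋-isEquivalence using () renaming (refl to ≋-refl; sym to ≋-sym; trans to ≋-trans)

  Movable-resp-≋ : ∀ {T U : Filling a} {r} → T ≋ U → Movable T r → Movable U r
  Movable-resp-≋ T≋U (rightOf , l , e , Tle≡r , leftmost , r<l) =
    (λ i j c d Uic≡r Ujd≡1+r → rightOf i j c d (trans (T≋U i c) Uic≡r) (trans (T≋U j d) Ujd≡1+r)) ,
    l , e , trans (sym (T≋U l e)) Tle≡r , (λ j d Ujd≡r → leftmost j d (trans (T≋U j d) Ujd≡r)) , r<l

  DstTerminal-resp-≋ : ∀ {T U : Filling a} → T ≋ U → DstTerminal U → DstTerminal T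
  DstTerminal-resp-≋ T≋U term r = term r ∘ Movable-resp-≋ T≋U

  DstStep-resp-≋ : ∀ {T T′ U : Filling a} → T ≋ T′ → DstStep T U →
                   ∃ λ U′ → DstStep T′ U′ × U ≋ U′
  DstStep-resp-≋ {T′ = T′} T≋T′ (r , mov , refl) =
    moveRow T′ r , (r , Movable-resp-≋ T≋T′ mov , refl) , λ i c → cong (raise r) (T≋T′ i c)

  DstTerminal⇒normal : ∀ {T : Filling a} → DstTerminal T → IsNormalForm DstStep T
  DstTerminal⇒normal term (_ , r , mov , _) = term r mov

  normal⇒DstTerminal : ∀ {T : Filling a} → IsNormalForm DstStep T → DstTerminal T
  normal⇒DstTerminal nf r mov = nf (-, r , mov , refl)

  DstTerminal-star : ∀ {T U : Filling a} → DstTerminal T → Star DstStep T U → T ≋ U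
  DstTerminal-star _    ε                  = ≋-refl
  DstTerminal-star term ((r , mov , _) ◅ _) = contradiction mov (term r)

  CondIII⇒column₁-highest : ∀ {T : Filling a} → CondIII T →
                            ∀ i (c : Fin (a i)) → T i c ≤ T i (column₁ (Fin⇒≢0 c))
  CondIII⇒column₁-highest iii i c
    with m≤n⇒m<n∨m≡n (subst (_≤ col c) (sym (col-column₁ (Fin⇒≢0 c))) (s≤s z≤n))
  ... | inj₁ c₁<c = iii i _ c c₁<c
  ... | inj₂ c₁≡c rewrite Fin.toℕ-injective (suc-injective c₁≡c) = ≤-refl

  -- By (iii) and (ii), a cell with entry r in row r forces the column-1 cell of that entry into
  -- row r too; it is then the leftmost cell of row r, whose entry exceeds r.
  Movable⇒row<entry : ∀ {T : Filling a} {r} → KT T → Movable T r →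
                      ∀ {i} {c : Fin (a i)} → T i c ≡ r → r < ent i
  Movable⇒row<entry {T} {r} (_ , distinct , ii , iii , _) (_ , l , e , Tle≡r , leftmost , r<l) {i} {c} Tic≡r =
    ≤∧≢⇒< (subst (_≤ ent i) Tic≡r (ii i c)) r≢i
    where
    c₁ : Fin (a i)
    c₁ = column₁ (Fin⇒≢0 c)
    r≢i : r ≢ ent i
    r≢i r≡i = <-irrefl (cong ent (sym l≡i)) (subst (_< ent l) r≡i r<l)
      where
      Tic₁≡r : T i c₁ ≡ r
      Tic₁≡r = ≤-antisym (subst (T i c₁ ≤_) (sym r≡i) (ii i c₁))
                         (subst (_≤ T i c₁) Tic≡r (CondIII⇒column₁-highest iii i c))
      l≡i : l ≡ i
      l≡i = distinct l i e c₁
              (trans (col≤1⇒≡1 e (subst (col e ≤_) (col-column₁ _) (leftmost i c₁ Tic₁≡r))) (sym (col-column₁ _)))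
              (trans Tle≡r (sym Tic₁≡r))

  KT-moveRow : ∀ {T : Filling a} {r} → KT T → Movable T r → KT (moveRow T r)
  KT-moveRow {T} {r} kt@(positive , distinct , ii , iii , iv) mov@(rightOf , _) =
    positive′ , distinct′ , ii′ , (λ i c d c<d → raise-mono-≤ r (iii i c d c<d)) , iv′
    where
    positive′ : RowsPositive (moveRow T r)
    positive′ i c = ≤-trans (positive i c) (raise-inflationary r (T i c))

    distinct′ : Distinct (moveRow T r)
    distinct′ i j c d c≡d row≡ with raise-view r (T i c) | raise-view r (T j d)
    ... | raised Tic≡r _ | raised Tjd≡r _ = distinct i j c d c≡d (trans Tic≡r (sym Tjd≡r))
    ... | kept _ ei      | kept _ ej      = distinct i j c d c≡d (trans (sym ei) (trans row≡ ej))
    ... | raised Tic≡r ei | kept _ ej     =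
      contradiction (rightOf i j c d Tic≡r (trans (sym ej) (trans (sym row≡) ei))) (<-irrefl (sym c≡d))
    ... | kept _ ei      | raised Tjd≡r ej =
      contradiction (rightOf j i d c Tjd≡r (trans (sym ei) (trans row≡ ej))) (<-irrefl c≡d)

    ii′ : CondII (moveRow T r)
    ii′ i c with raise-view r (T i c)
    ... | raised Tic≡r ei = subst (_≤ ent i) (sym ei) (Movable⇒row<entry kt mov Tic≡r)
    ... | kept _ ei       = subst (_≤ ent i) (sym ei) (ii i c)

    iv′ : CondIV (moveRow T r)
    iv′ i j c d i<j c≡d below with iv i j c d i<j c≡d (raise-cancel-< r below)
    ... | e , e≡c+1 , Tjd<Tie = e , e≡c+1 , raise-mono-< r Tjd<Tie e-not-above
      where
      e-not-above : T j d ≡ r → T i e ≢ suc r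
      e-not-above Tjd≡r Tie≡1+r =
        <⇒≱ (rightOf j i d e Tjd≡r Tie≡1+r)
            (subst (col d ≤_) (sym (trans e≡c+1 (cong suc c≡d))) (n≤1+n (col d)))

  -- The truncated subtraction is harmless: movable rows lie below row n.
  μ : Filling a → ℕ
  μ T = ∑[ i < n ] ∑[ c < a i ] (n ∸ T i c)

  μ-moveRow : ∀ {T : Filling a} {r} → Movable T r → μ (moveRow T r) < μ T
  μ-moveRow {T} {r} (_ , l , e , Tle≡r , _ , r<l) =
    sum-mono-< (λ i → sum-mono-≤ (λ c → ∸-monoʳ-≤ n (raise-inflationary r (T i c)))) l
      (sum-mono-< (λ c → ∸-monoʳ-≤ n (raise-inflationary r (T l c))) e
        (subst₂ (λ x y → n ∸ x < n ∸ y) (sym (raise-≡ Tle≡r)) (sym Tle≡r)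
          (∸-monoʳ-< (n<1+n r) (≤-trans r<l (Fin.toℕ<n l)))))

  DstStep-stronglyNormalizing : StronglyNormalizing (DstStep {a = a})
  DstStep-stronglyNormalizing =
    Subrelation.wellFounded (λ { (r , mov , refl) → μ-moveRow mov }) (On.wellFounded μ <-wellFounded)

  Movable⇒row<n : ∀ {T : Filling a} {r} → Movable T r → r < n
  Movable⇒row<n (_ , l , _ , refl , _ , r<l) = <-≤-trans r<l (Fin.toℕ<n l)

  Movable? : (T : Filling a) (r : ℕ) → Dec (Movable T r)
  Movable? T r =
    (Fin.all? λ i → Fin.all? λ j → Fin.all? λ c → Fin.all? λ d →
       (T i c ≟ r) →-dec ((T j d ≟ suc r) →-dec (col d <? col c)))
    ×-dec (Fin.any? λ l → Fin.any? λ e → (T l e ≟ r) ×-dec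
       ((Fin.all? λ j → Fin.all? λ d → (T j d ≟ r) →-dec (col e ≤? col d)) ×-dec (r <? ent l)))

  DstStep? : (T : Filling a) → Dec (∃ λ U → DstStep T U)
  DstStep? T with Fin.any? (λ (r : Fin n) → Movable? T (toℕ r))
  ... | yes (r , mov) = yes (-, toℕ r , mov , refl)
  ... | no  none      = no λ (_ , r , mov , _) →
    none (fromℕ< (Movable⇒row<n mov) , subst (Movable T) (sym (Fin.toℕ-fromℕ< _)) mov)

  IsLeftmostIn : Filling a → ℕ → (l : Fin n) → Fin (a l) → Set
  IsLeftmostIn T r l e = T l e ≡ r × ((j : Fin n) (d : Fin (a j)) → T j d ≡ r → col e ≤ col d)

  leftmostCell : (T : Filling a) {r : ℕ} {i : Fin n} (c : Fin (a i)) → T i c ≡ r →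
                 Σ[ l ∈ Fin n ] Σ[ e ∈ Fin (a l) ] IsLeftmostIn T r l e
  leftmostCell T {r} c = go c (<-wellFounded (col c))
    where
    go : ∀ {i} (c : Fin (a i)) → Acc _<_ (col c) → T i c ≡ r → Σ[ l ∈ Fin n ] Σ[ e ∈ Fin (a l) ] IsLeftmostIn T r l e
    go {i} c (acc rs) Tic≡r with Fin.any? (λ j → Fin.any? λ d → (T j d ≟ r) ×-dec (col d <? col c))
    ... | yes (j , d , Tjd≡r , d<c) = go d (rs d<c) Tjd≡r
    ... | no  nothing-left          =
      i , c , Tic≡r , λ j d Tjd≡r → ≮⇒≥ λ d<c → nothing-left (j , d , Tjd≡r , d<c)

  quasiYamanouchi⇒DstTerminal : ∀ {T : Filling a} → KT T → QuasiYamanouchi T → DstTerminal T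
  quasiYamanouchi⇒DstTerminal kt qy r mov@(rightOf , l , e , Tle≡r , _) with qy r (l , e , Tle≡r)
  ... | inj₁ (i , c , Tic≡r , i≡r)               = <-irrefl (sym i≡r) (Movable⇒row<entry kt mov Tic≡r)
  ... | inj₂ (i , c , j , d , Tic≡r , Tjd≡1+r , c≤d) = <⇒≱ (rightOf i j c d Tic≡r Tjd≡1+r) c≤d

  DstTerminal⇒quasiYamanouchi : ∀ {T : Filling a} → KT T → DstTerminal T → QuasiYamanouchi T
  DstTerminal⇒quasiYamanouchi {T} (_ , _ , ii , _) term r (i , c , Tic≡r)
    with Fin.any? (λ i → Fin.any? λ c → Fin.any? λ j → Fin.any? λ d →
           (T i c ≟ r) ×-dec ((T j d ≟ suc r) ×-dec (col c ≤? col d)))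
  ... | yes weakly-right = inj₂ weakly-right
  ... | no  strictly-left with leftmostCell T c Tic≡r
  ...   | l , e , Tle≡r , leftmost with r <? ent l
  ...     | yes r<l = contradiction (rightOf , l , e , Tle≡r , leftmost , r<l) (term r)
    where
    rightOf : (i j : Fin n) (c : Fin (a i)) (d : Fin (a j)) → T i c ≡ r → T j d ≡ suc r → col d < col c
    rightOf i j c d Tic≡r Tjd≡1+r = ≰⇒> λ c≤d → strictly-left (i , c , j , d , Tic≡r , Tjd≡1+r , c≤d)
  ...     | no r≮l = inj₁ (l , e , Tle≡r , ≤-antisym (≮⇒≥ r≮l) (subst (_≤ ent l) Tle≡r (ii l e)))

  Movable-moveRow-far : ∀ {T : Filling a} {r s} → s ≢ r → s ≢ suc r → Movable T s → Movable (moveRow T r) s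
  Movable-moveRow-far s≢r s≢1+r (rightOf , l , e , Tle≡s , leftmost , s<l) =
    (λ i j c d ei ej → rightOf i j c d (raise-unmoved ei s≢1+r) (raise-unmoved ej (s≢r ∘ suc-injective))) ,
    l , e , trans (raise-≢ (s≢r ∘ trans (sym Tle≡s))) Tle≡s ,
    (λ j d ej → leftmost j d (raise-unmoved ej s≢1+r)) , s<l

  Movable-moveRow-merged : ∀ {T : Filling a} {r} → Movable T r → Movable T (suc r) → Movable (moveRow T r) (suc r)
  Movable-moveRow-merged {T} {r} (rightOf₀ , _) (rightOf₁ , l₁ , e₁ , Tl₁e₁≡1+r , leftmost₁ , 1+r<l₁) =
    rightOf , l₁ , e₁ , trans (raise-≢ (1+n≢n ∘ trans (sym Tl₁e₁≡1+r))) Tl₁e₁≡1+r , leftmost , 1+r<l₁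
    where
    from-row₂ : ∀ {j} {d : Fin (a j)} → raise r (T j d) ≡ suc (suc r) → T j d ≡ suc (suc r)
    from-row₂ ej = raise-unmoved ej 1+n≢n

    rightOf : (i j : Fin n) (c : Fin (a i)) (d : Fin (a j)) →
              raise r (T i c) ≡ suc r → raise r (T j d) ≡ suc (suc r) → col d < col c
    rightOf i j c d ei ej with raise-view r (T i c)
    ... | raised Tic≡r _ =
      <-trans (rightOf₁ l₁ j e₁ d Tl₁e₁≡1+r (from-row₂ ej)) (rightOf₀ i l₁ c e₁ Tic≡r Tl₁e₁≡1+r)
    ... | kept _ eq      = rightOf₁ i j c d (trans (sym eq) ei) (from-row₂ ej)

    leftmost : (j : Fin n) (d : Fin (a j)) → raise r (T j d) ≡ suc r → col e₁ ≤ col d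
    leftmost j d ej with raise-view r (T j d)
    ... | raised Tjd≡r _ = <⇒≤ (rightOf₀ j l₁ d e₁ Tjd≡r Tl₁e₁≡1+r)
    ... | kept _ eq      = leftmost₁ j d (trans (sym eq) ej)

  Movable-moveRow-separated : ∀ {T : Filling a} {r} → KT T → Movable T r → Movable T (suc r) →
                              Movable (moveRow (moveRow T (suc r)) r) (suc r)
  Movable-moveRow-separated {T} {r} kt mov₀@(rightOf₀ , l₀ , e₀ , Tl₀e₀≡r , leftmost₀ , _)
                                      mov₁@(rightOf₁ , l₁ , e₁ , Tl₁e₁≡1+r , _) =
    rightOf , l₀ , e₀ , raised-l₀ , (λ j d ej → leftmost₀ j d (raise²-preimage ej)) , 1+r<l₀
    where
    raised-l₀ : raise r (raise (suc r) (T l₀ e₀)) ≡ suc r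
    raised-l₀ = trans (cong (raise r) (raise-≢ (1+n≢n ∘ sym ∘ trans (sym Tl₀e₀≡r)))) (raise-≡ Tl₀e₀≡r)

    rightOf : (i j : Fin n) (c : Fin (a i)) (d : Fin (a j)) →
              raise r (raise (suc r) (T i c)) ≡ suc r → raise r (raise (suc r) (T j d)) ≡ suc (suc r) → col d < col c
    rightOf i j c d ei ej with raise-view (suc r) (T j d)
    ... | raised Tjd≡1+r _ = rightOf₀ i j c d (raise²-preimage ei) Tjd≡1+r
    ... | kept _ eq        =
      <-trans (rightOf₁ l₁ j e₁ d Tl₁e₁≡1+r (raise-unmoved (trans (cong (raise r) (sym eq)) ej) 1+n≢n))
              (rightOf₀ i l₁ c e₁ (raise²-preimage ei) Tl₁e₁≡1+r)

    1+r<l₀ : suc r < ent l₀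
    1+r<l₀ = Movable⇒row<entry (KT-moveRow kt mov₀) (Movable-moveRow-merged mov₀ mov₁) (raise-≡ Tl₀e₀≡r)

  Joinable : Filling a → Filling a → Set
  Joinable U V = ∃₂ λ U′ V′ → Star DstStep U U′ × Star DstStep V V′ × U′ ≋ V′

  Joinable-sym : ∀ {U V : Filling a} → Joinable U V → Joinable V U
  Joinable-sym (U′ , V′ , U↠U′ , V↠V′ , U′≋V′) = V′ , U′ , V↠V′ , U↠U′ , ≋-sym U′≋V′

  -- Starting with row r+1, two further moves are needed to stack rows r and r+1 in row r+2.
  moveRow-adjacent-joinable : ∀ {T : Filling a} {r} → KT T → Movable T r → Movable T (suc r) →
                              Joinable (moveRow T r) (moveRow T (suc r))
  moveRow-adjacent-joinable {T} {r} kt mov₀ mov₁ =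
    -, -,
    (suc r , Movable-moveRow-merged mov₀ mov₁ , refl) ◅ ε ,
    (r , Movable-moveRow-far (≢-sym 1+n≢n) (n≢2+n r) mov₀ , refl) ◅
      (suc r , Movable-moveRow-separated kt mov₀ mov₁ , refl) ◅ ε ,
    λ i c → raise-adjacent r (T i c)

  DstStep-weaklyConfluent : ∀ {T U V : Filling a} → KT T → DstStep T U → DstStep T V → Joinable U V
  DstStep-weaklyConfluent {T} kt (r , mov-r , refl) (s , mov-s , refl) with r ≟ s | s ≟ suc r | r ≟ suc s
  ... | yes refl | _ | _ = -, -, ε , ε , ≋-refl
  ... | no _ | yes refl | _ = moveRow-adjacent-joinable kt mov-r mov-s
  ... | no _ | no _ | yes refl = Joinable-sym (moveRow-adjacent-joinable kt mov-s mov-r)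
  ... | no r≢s | no s≢1+r | no r≢1+s =
    -, -,
    (s , Movable-moveRow-far (r≢s ∘ sym) s≢1+r mov-s , refl) ◅ ε ,
    (r , Movable-moveRow-far r≢s r≢1+s mov-r , refl) ◅ ε ,
    λ i c → raise-comm (r≢s ∘ sym) s≢1+r r≢1+s (T i c)

  KT-DstStep : ∀ {T U : Filling a} → KT T → DstStep T U → KT U
  KT-DstStep kt (_ , mov , refl) = KT-moveRow kt mov

  open NewmanModulo ≋-isEquivalence DstStep-resp-≋ KT KT-DstStep
                    DstStep-weaklyConfluent DstStep-stronglyNormalizing DstStep?

  Dst-exists : (T : Filling a) → Σ (Filling a) (Dst T)
  Dst-exists T = let U , nf , T↠U = normalise T in U , T↠U , normal⇒DstTerminal nf

  Dst-unique : ∀ {T U U′ : Filling a} → KT T → Dst T U → Dst T U′ → U ≋ U′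
  Dst-unique kt (T↠U , term) (T↠U′ , term′) =
    normalForm-unique kt ≋-refl T↠U T↠U′ (DstTerminal⇒normal term) (DstTerminal⇒normal term′)

  QKT-Dst : ∀ {T U : Filling a} → KT T → Dst T U → QKT U
  QKT-Dst kt (T↠U , term) = let ktU = Inv-star kt T↠U in ktU , DstTerminal⇒quasiYamanouchi ktU term

  NoGap : Set
  NoGap = (i j : Fin n) → i <ᶠ j → a i ≡ 0 → a j ≡ 0

  NoGap⇒earlier-occupied : NoGap → ∀ {i t} → Fin (a i) → t < toℕ i →
                           Σ[ q ∈ Fin n ] toℕ q ≡ t × a q ≢ 0
  NoGap⇒earlier-occupied noGap {i} {t} c t<i =
    q , toℕq≡t , λ aq≡0 → Fin⇒≢0 c (noGap q i (subst (_< toℕ i) (sym toℕq≡t) t<i) aq≡0)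
    where
    q : Fin n
    q = fromℕ< (<-trans t<i (Fin.toℕ<n i))
    toℕq≡t : toℕ q ≡ t
    toℕq≡t = Fin.toℕ-fromℕ< _

  NoGap⇒column₁-row≡entry : NoGap → ∀ {T : Filling a} → KT T →
                            ∀ i (c : Fin (a i)) → col c ≡ 1 → T i c ≡ ent i
  NoGap⇒column₁-row≡entry noGap {T} (positive , distinct , ii , _) i = go i (<-wellFounded (toℕ i))
    where
    go : ∀ i → Acc _<_ (toℕ i) → (c : Fin (a i)) → col c ≡ 1 → T i c ≡ ent i
    go i (acc rs) c c≡1 with T i c in Tic≡ | positive i c | ii i c
    ... | suc t | _ | s≤s t≤i with m≤n⇒m<n∨m≡n t≤i
    ...   | inj₂ t≡i = cong suc t≡i
    ...   | inj₁ t<i with NoGap⇒earlier-occupied noGap c t<i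
    ...     | q , toℕq≡t , aq≢0 = contradiction (cong toℕ q≡i) (<⇒≢ q<i)
      where
      q<i : toℕ q < toℕ i
      q<i = subst (_< toℕ i) (sym toℕq≡t) t<i
      c₁ : Fin (a q)
      c₁ = column₁ aq≢0
      q≡i : q ≡ i
      q≡i = distinct q i c₁ c (trans (col-column₁ aq≢0) (sym c≡1))
                     (trans (go q (rs q<i) c₁ (col-column₁ aq≢0)) (trans (cong suc toℕq≡t) (sym Tic≡)))

  NoGap⇒DstTerminal : NoGap → ∀ {T : Filling a} → KT T → DstTerminal T
  NoGap⇒DstTerminal noGap (positive , _) zero (_ , l , e , Tle≡0 , _) =
    contradiction (subst (1 ≤_) Tle≡0 (positive l e)) λ ()
  NoGap⇒DstTerminal noGap {T} kt (suc r) mov@(_ , l , e , _ , _ , s≤s r<l) with NoGap⇒earlier-occupied noGap e r<l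
  ... | q , toℕq≡r , aq≢0 = <-irrefl (cong suc (sym toℕq≡r)) (Movable⇒row<entry kt mov Tqc₁≡1+r)
    where
    Tqc₁≡1+r : T q (column₁ aq≢0) ≡ suc r
    Tqc₁≡1+r = trans (NoGap⇒column₁-row≡entry noGap kt q (column₁ aq≢0) (col-column₁ aq≢0))
                     (cong suc toℕq≡r)

  DstInjective : Set
  DstInjective = (T T′ U U′ : Filling a) → KT T → KT T′ → Dst T U → Dst T′ U′ → U ≋ U′ → T ≋ T′

  NoGap⇒DstInjective : NoGap → DstInjective
  NoGap⇒DstInjective noGap T T′ U U′ kt kt′ (T↠U , _) (T′↠U′ , _) U≋U′ =
    ≋-trans (DstTerminal-star (NoGap⇒DstTerminal noGap kt) T↠U)
            (≋-trans U≋U′ (≋-sym (DstTerminal-star (NoGap⇒DstTerminal noGap kt′) T′↠U′)))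

  flat : (Fin n → ℕ) → Filling a
  flat ρ i _ = ρ i

  KT-flat : ∀ {ρ} → (∀ i → 1 ≤ ρ i) → (∀ i → toℕ i ≤ ρ i) → (∀ i → ρ i ≤ ent i) →
            (∀ i j → Fin (a i) → Fin (a j) → ρ i ≡ ρ j → i ≡ j) → KT (flat ρ)
  KT-flat positive lower upper injective =
    (λ i _ → positive i) , (λ i j c d _ → injective i j c d) , (λ i _ → upper i) , (λ _ _ _ _ → ≤-refl) ,
    λ i j _ _ i<j _ below → contradiction (≤-trans (upper i) (≤-trans i<j (lower j))) (<⇒≱ below)

  ent-injective : ∀ {i j : Fin n} → ent i ≡ ent j → i ≡ j
  ent-injective = Fin.toℕ-injective ∘ suc-injective

  KT-flat-ent : KT (flat ent)
  KT-flat-ent = KT-flat (λ _ → s≤s z≤n) (λ i → n≤1+n (toℕ i)) (λ _ → ≤-refl) (λ _ _ _ _ → ent-injective)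

  DstTerminal-flat-ent : DstTerminal (flat ent)
  DstTerminal-flat-ent r (_ , _ , _ , l≡r , _ , r<l) = <-irrefl (sym l≡r) r<l

  lowerAt : Fin n → Fin n → ℕ
  lowerAt q′ i = if ⌊ i Fin.≟ q′ ⌋ then toℕ i else ent i

  module _ {q q′ : Fin n} (q′≡1+q : toℕ q′ ≡ suc (toℕ q)) (aq≡0 : a q ≡ 0) where

    private
      T₁ : Filling a
      T₁ = flat (lowerAt q′)

      unoccupied : ∀ {i} → Fin (a i) → ent i ≢ ent q
      unoccupied c i≡q = Fin⇒≢0 c (subst (λ k → a k ≡ 0) (sym (ent-injective i≡q)) aq≡0)

    KT-lowered : KT T₁
    KT-lowered = KT-flat positive lower upper injective
      where
      positive : ∀ i → 1 ≤ lowerAt q′ i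
      positive i with i Fin.≟ q′
      ... | yes refl = subst (1 ≤_) (sym q′≡1+q) (s≤s z≤n)
      ... | no  _    = s≤s z≤n
      lower : ∀ i → toℕ i ≤ lowerAt q′ i
      lower i with i Fin.≟ q′
      ... | yes _ = ≤-refl
      ... | no  _ = n≤1+n (toℕ i)
      upper : ∀ i → lowerAt q′ i ≤ ent i
      upper i with i Fin.≟ q′
      ... | yes _ = n≤1+n (toℕ i)
      ... | no  _ = ≤-refl
      injective : ∀ i j → Fin (a i) → Fin (a j) → lowerAt q′ i ≡ lowerAt q′ j → i ≡ j
      injective i j c d eq with i Fin.≟ q′ | j Fin.≟ q′
      ... | yes i≡q′ | yes j≡q′ = trans i≡q′ (sym j≡q′)
      ... | yes refl | no  _    = contradiction (trans (sym eq) q′≡1+q) (unoccupied d)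
      ... | no  _    | yes refl = contradiction (trans eq q′≡1+q) (unoccupied c)
      ... | no  _    | no  _    = ent-injective eq

    lowerAt-self : lowerAt q′ q′ ≡ ent q
    lowerAt-self with q′ Fin.≟ q′
    ... | yes _   = q′≡1+q
    ... | no q′≢q′ = contradiction refl q′≢q′

    Movable-lowered : a q′ ≢ 0 → Movable T₁ (ent q)
    Movable-lowered aq′≢0 =
      (λ i j c d _ eq → contradiction eq (row-above-empty j d)) , q′ , column₁ aq′≢0 , lowerAt-self ,
      (λ j d _ → subst (_≤ col d) (sym (col-column₁ aq′≢0)) (s≤s z≤n)) , s≤s (≤-reflexive (sym q′≡1+q))
      where
      row-above-empty : ∀ j → Fin (a j) → lowerAt q′ j ≢ suc (ent q)
      row-above-empty j d eq with j Fin.≟ q′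
      ... | yes refl = 1+n≢n (trans (sym eq) q′≡1+q)
      ... | no  j≢q′ = j≢q′ (ent-injective (trans eq (cong suc (sym q′≡1+q))))

    moveRow-lowered : moveRow T₁ (ent q) ≋ flat ent
    moveRow-lowered i c with i Fin.≟ q′
    ... | yes refl = trans (raise-≡ q′≡1+q) (cong suc (sym q′≡1+q))
    ... | no  _    = raise-≢ (unoccupied c)

  Gap⇒¬DstInjective : ∀ {q q′} → toℕ q′ ≡ suc (toℕ q) → a q ≡ 0 → a q′ ≢ 0 → ¬ DstInjective
  Gap⇒¬DstInjective {q} {q′} q′≡1+q aq≡0 aq′≢0 injective =
    1+n≢n (trans (flat-ent≋lowered q′ (column₁ aq′≢0)) (trans (lowerAt-self q′≡1+q aq≡0) (sym q′≡1+q)))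
    where
    flat-ent≋lowered : flat ent ≋ flat (lowerAt q′)
    flat-ent≋lowered =
      injective (flat ent) (flat (lowerAt q′)) (flat ent) (moveRow (flat (lowerAt q′)) (ent q))
        KT-flat-ent (KT-lowered q′≡1+q aq≡0)
        (ε , DstTerminal-flat-ent)
        ((ent q , Movable-lowered q′≡1+q aq≡0 aq′≢0 , refl) ◅ ε ,
         DstTerminal-resp-≋ (moveRow-lowered q′≡1+q aq≡0) DstTerminal-flat-ent)
        (≋-sym (moveRow-lowered q′≡1+q aq≡0))

  DstInjective⇒NoGap : DstInjective → NoGap
  DstInjective⇒NoGap injective i j i<j ai≡0 with a j ≟ 0
  ... | yes aj≡0 = aj≡0
  ... | no  aj≢0 =
    let _ , _ , q′≡1+q , aq≡0 , aq′≢0 = adjacent-switch (λ k → a k ≟ 0) i<j ai≡0 aj≢0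
    in contradiction injective (Gap⇒¬DstInjective q′≡1+q aq≡0 aq′≢0)

  QKT⇒Dst-self : ∀ {T : Filling a} → QKT T → Dst T T
  QKT⇒Dst-self (kt , qy) = ε , quasiYamanouchi⇒DstTerminal kt qy

  Dst-fixes⇔QKT : ∀ {T : Filling a} → KT T → (Σ (Filling a) λ U → Dst T U × U ≋ T) ⇔ QKT T
  Dst-fixes⇔QKT kt = mk⇔
    (λ (_ , (_ , term) , U≋T) → kt , DstTerminal⇒quasiYamanouchi kt (DstTerminal-resp-≋ (≋-sym U≋T) term))
    (λ qkt → -, QKT⇒Dst-self qkt , ≋-refl)

lemma2p12 : (n : ℕ) (a : Fin n → ℕ) →
    ((T : Filling a) → KT T → Σ (Filling a) λ U → Dst T U)
    × ((T U U′ : Filling a) → KT T → Dst T U → Dst T U′ → U ≋ U′)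
    × ((T U : Filling a) → KT T → Dst T U → QKT U)
    × ((T : Filling a) → KT T → ((Σ (Filling a) λ U → Dst T U × U ≋ T) ⇔ QKT T))
    × ((U : Filling a) → QKT U →
         Σ (Filling a) λ T → KT T × (Σ (Filling a) λ U′ → Dst T U′ × U′ ≋ U))
    × (((T T′ U U′ : Filling a) → KT T → KT T′ → Dst T U → Dst T′ U′ →
          U ≋ U′ → T ≋ T′)
       ⇔ ((i j : Fin n) → i <ᶠ j → a i ≡ 0 → a j ≡ 0))
lemma2p12 n a =
  (λ T _ → Dst-exists T) ,
  (λ _ _ _ → Dst-unique) ,
  (λ _ _ → QKT-Dst) ,
  (λ _ → Dst-fixes⇔QKT) ,
  (λ U qkt → U , proj₁ qkt , U , QKT⇒Dst-self qkt , λ _ _ → refl) ,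
  mk⇔ DstInjective⇒NoGap NoGap⇒DstInjective
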